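{- Let $\mathcal{C}$ be a symmetric collection of sub-intervals $[p,q]$ (with $1\le p<q\le n$) of the integer interval $[1,n]$. Let $G_{\mathcal{C}}$ be the group with generators $s_I$, $I\in\mathcal{C}$, and as relations all relations of types (j1)–(j3) of $J_n$ that involve only generators $s_I$ with $I \in \mathcal{C}$. Then the natural homomorphism $G_{\mathcal{C}} \to J_n$, $s_I\mapsto s_I$, is injective; i.e. the set of generators $\{s_I \mid I\in\mathcal{C}\}$ is complete.
   Context: For $n \ge 2$, the cactus group $J_n$ is the group with generators $s_{p,q}$ ($=s_{[p,q]}$) for $1 \le p < q \le n$ and relations: (j1) $s_{p,q}^2 = 1$; (j2) $s_{p,q}s_{m,r} = s_{m,r}s_{p,q}$ whenever $[p,q]\cap[m,r]=\emptyset$; (j3) $s_{p,q}s_{m,r} = s_{p+q-r,\,p+q-m}\,s_{p,q}$ whenever $[m,r]\subset[p,q]$. Given a group presentation $\langle S\mid R\rangle$ and a subset $I\subseteq S$, one forms $\langle I \mid R_I\rangle$ where $R_I$ consists of the relations of $R$ involving only generators in $I$; $I$ is called complete if the natural map $\langle I\mid R_I\rangle \to \langle S\mid R\rangle$ is injective. A collection $\mathcal{C}$ of sub-intervals of $[1,n]$ is called symmetric if whenever $[m,r]\subset[p,q]$ are both in $\mathcal{C}$, the interval $[p+q-r,\,p+q-m]$ is also in $\mathcal{C}$. -}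

module Defs where

open import Data.Nat using (ℕ; _+_; _≤_; _<_)
open import Data.Product using (Σ; _×_; _,_; proj₁; proj₂)
open import Data.Sum using (_⊎_)
open import Data.List using (List; []; _∷_; _++_; map)
open import Relation.Binary.PropositionalEquality using (_≡_)

data Letter (S : Set) : Set where
  pos : S → Letter S
  neg : S → Letter S

inv : {S : Set} → Letter S → Letter S
inv (pos s) = neg s
inv (neg s) = pos s

mapLetter : {S T : Set} → (S → T) → Letter S → Letter T
mapLetter f (pos s) = pos (f s)
mapLetter f (neg s) = neg (f s)

Word : Set → Set
Word S = List (Letter S)

mapWord : {S T : Set} → (S → T) → Word S → Word T
mapWord f = map (mapLetter f)

Relations : Set → Set₁
Relations S = Word S → Word S → Set

-- Equality in the group ⟨ S ∣ R ⟩: the congruence on words generated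
-- by free cancellation and the relations.
data _⊢_≈_ {S : Set} (R : Relations S) : Word S → Word S → Set where
  ≈-refl   : ∀ {u} → R ⊢ u ≈ u
  ≈-sym    : ∀ {u v} → R ⊢ u ≈ v → R ⊢ v ≈ u
  ≈-trans  : ∀ {u v w} → R ⊢ u ≈ v → R ⊢ v ≈ w → R ⊢ u ≈ w
  ≈-cong   : ∀ {u v} (a b : Word S) → R ⊢ u ≈ v → R ⊢ (a ++ u ++ b) ≈ (a ++ v ++ b)
  ≈-cancel : ∀ (x : Letter S) → R ⊢ (x ∷ inv x ∷ []) ≈ []
  ≈-rel    : ∀ {u v} → R u v → R ⊢ u ≈ v

-- Relations R_I: the relations of R involving only generators in I
-- (I given as a predicate on S; generators of the subpresentation are Σ S I).
restrict : {S : Set} → Relations S → (I : S → Set) → Relations (Σ S I)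
restrict R I u v = R (mapWord proj₁ u) (mapWord proj₁ v)

-- I is complete: the natural map ⟨ I ∣ R_I ⟩ → ⟨ S ∣ R ⟩ is injective.
Complete : {S : Set} → Relations S → (I : S → Set) → Set
Complete {S} R I = ∀ (u v : Word (Σ S I)) →
  R ⊢ mapWord proj₁ u ≈ mapWord proj₁ v → restrict R I ⊢ u ≈ v

ValidInterval : ℕ → ℕ × ℕ → Set
ValidInterval n (p , q) = (1 ≤ p) × (p < q) × (q ≤ n)

Gen : ℕ → Set
Gen n = Σ (ℕ × ℕ) (ValidInterval n)

lo hi : {n : ℕ} → Gen n → ℕ
lo g = proj₁ (proj₁ g)
hi g = proj₂ (proj₁ g)

Disjoint : {n : ℕ} → Gen n → Gen n → Set
Disjoint a b = (hi a < lo b) ⊎ (hi b < lo a)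

Contained : {n : ℕ} → Gen n → Gen n → Set
Contained b a = (lo a ≤ lo b) × (hi b ≤ hi a)

-- c is the reflection of b inside a: c = [p+q-r, p+q-m]
-- (stated additively to avoid truncated subtraction)
Reflection : {n : ℕ} → Gen n → Gen n → Gen n → Set
Reflection a b c = (lo c + hi b ≡ lo a + hi a) × (hi c + lo b ≡ lo a + hi a)

data CactusRel (n : ℕ) : Relations (Gen n) where
  j1 : ∀ (a : Gen n) → CactusRel n (pos a ∷ pos a ∷ []) []
  j2 : ∀ (a b : Gen n) → Disjoint a b →
       CactusRel n (pos a ∷ pos b ∷ []) (pos b ∷ pos a ∷ [])
  j3 : ∀ (a b c : Gen n) → Contained b a → Reflection a b c →
       CactusRel n (pos a ∷ pos b ∷ []) (pos c ∷ pos a ∷ [])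

Symmetric : {n : ℕ} → (Gen n → Set) → Set
Symmetric {n} C = ∀ (a b c : Gen n) → C a → C b → Contained b a →
  Reflection a b c → C c

-- Send s_I to the pair (reversal of I, the subset I) in S_n ⋉ W, where W is the
-- right-angled Coxeter group on the subsets of [1, n] in which nested or disjoint
-- subsets commute; elements of W are reduced words up to commuting adjacent letters.
-- Any word in the generators of C can be rewritten, by relations among those
-- generators only, into one whose image in W is reduced, because the subset attached
-- to a letter determines its interval. If two such words agree in J_n, their reduced
-- images differ by commutations, and each commutation of adjacent letters lifts to a
-- relation (j2) or (j3) among generators of C: the reflected interval occurring in
-- (j3) lies in C because C is symmetric.
module Submission where

open import Defs
open import Data.Bool using (Bool; true; false; not; _∧_; _∨_; if_then_else_)
import Data.Bool as Bool
open import Data.Bool.Properties using (∧-comm)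
open import Data.Empty using (⊥; ⊥-elim)
open import Data.List using (List; []; _∷_; _++_)
import Data.List.Properties as List
open import Data.Maybe using (Maybe; just; nothing; maybe′)
import Data.Maybe as Maybe
open import Data.Maybe.Relation.Binary.Pointwise using (Pointwise; just; nothing)
open import Data.Nat using (ℕ; zero; suc; _+_; _∸_; _≤_; _<_; _≤?_; _<?_)
import Data.Nat as ℕ
open import Data.Nat.Properties
  using ( ≤-refl; ≤-trans; ≤-antisym; ≤-pred; ≤-irrelevant; <-irrelevant; <⇒≤; <⇒≱; ≰⇒>; ≮⇒≥
        ; ≤∧≢⇒<; ≤-<-trans; <-≤-trans; +-comm; +-monoʳ-≤; +-monoʳ-<; +-cancelʳ-≤; +-cancelʳ-<
        ; +-cancelʳ-≡; m≤n+m; m∸n+n≡m; m+n∸m≡n )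
open import Data.Nat.Tactic.RingSolver using (solve-∀)
open import Data.Product using (Σ; Σ-syntax; _×_; _,_; proj₁; proj₂)
open import Data.Sum using (_⊎_; inj₁; inj₂)
open import Data.Unit using (⊤; tt)
open import Function using (id; _∘_)
open import Relation.Binary.Construct.Closure.ReflexiveTransitive
  using (Star; ε; _◅_; _◅◅_; gmap; reverse)
open import Relation.Binary.Definitions using (DecidableEquality)
open import Relation.Binary.PropositionalEquality
open import Relation.Nullary using (yes; no)

-- A word of the right-angled Coxeter group with commutation relation _#_ is stored
-- reversed (head = last letter); act r multiplies by r on the right, cancelling
-- against the last occurrence of r that can be commuted to the end.
module ReducedWords
  {A : Set} (_≟_ : DecidableEquality A)
  (_#_ : A → A → Bool) (#-sym : ∀ a b → a # b ≡ b # a) where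

  Commute : A → A → Set
  Commute a b = a # b ≡ true

  Commute-sym : ∀ {a b} → Commute a b → Commute b a
  Commute-sym {a} {b} c = trans (#-sym b a) c

  data Swap : List A → List A → Set where
    here  : ∀ {a b t} → Commute a b → Swap (a ∷ b ∷ t) (b ∷ a ∷ t)
    there : ∀ {h t t′} → Swap t t′ → Swap (h ∷ t) (h ∷ t′)

  _∼_ : List A → List A → Set
  _∼_ = Star Swap

  Swap-sym : ∀ {x y} → Swap x y → Swap y x
  Swap-sym (here c)  = here (Commute-sym c)
  Swap-sym (there s) = there (Swap-sym s)

  ∼-sym : ∀ {x y} → x ∼ y → y ∼ x
  ∼-sym = reverse Swap-sym

  ∼-∷ : ∀ h {x y} → x ∼ y → (h ∷ x) ∼ (h ∷ y)
  ∼-∷ h = gmap (h ∷_) there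

  delete : A → List A → Maybe (List A)
  delete r []      = nothing
  delete r (h ∷ t) with h ≟ r | h # r
  ... | yes _ | _     = just t
  ... | no _  | true  = Maybe.map (h ∷_) (delete r t)
  ... | no _  | false = nothing

  act : A → List A → List A
  act r x = maybe′ id (r ∷ x) (delete r x)

  Reduced : List A → Set
  Reduced []      = ⊤
  Reduced (h ∷ t) = Reduced t × delete h t ≡ nothing

  data HeadCase (r h : A) : Set where
    matches : h ≡ r → HeadCase r h
    passes  : h ≢ r → Commute h r → HeadCase r h
    blocks  : h ≢ r → h # r ≡ false → HeadCase r h

  headCase : ∀ r h → HeadCase r h
  headCase r h with h ≟ r | h # r in e
  ... | yes h≡r | _     = matches h≡r
  ... | no h≢r  | true  = passes h≢r e
  ... | no h≢r  | false = blocks h≢r e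

  delete-here : ∀ r t → delete r (r ∷ t) ≡ just t
  delete-here r t with r ≟ r
  ... | yes _  = refl
  ... | no r≢r = ⊥-elim (r≢r refl)

  delete-past : ∀ r h t → h ≢ r → Commute h r → delete r (h ∷ t) ≡ Maybe.map (h ∷_) (delete r t)
  delete-past r h t h≢r c with h ≟ r
  ... | yes h≡r = ⊥-elim (h≢r h≡r)
  ... | no _ rewrite c = refl

  delete-blocked : ∀ r h t → h ≢ r → h # r ≡ false → delete r (h ∷ t) ≡ nothing
  delete-blocked r h t h≢r c with h ≟ r
  ... | yes h≡r = ⊥-elim (h≢r h≡r)
  ... | no _ rewrite c = refl

  commute-blocked : ∀ {a b} → Commute a b → a # b ≡ false → ⊥
  commute-blocked c b with () ← trans (sym c) b

  map-∷-resp : ∀ h {m m′} → Pointwise _∼_ m m′ → Pointwise _∼_ (Maybe.map (h ∷_) m) (Maybe.map (h ∷_) m′)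
  map-∷-resp h (just p) = just (∼-∷ h p)
  map-∷-resp h nothing  = nothing

  delete-swap : ∀ r {x y} → Swap x y → Pointwise _∼_ (delete r x) (delete r y)
  delete-swap r (here {a} {b} {t} c) with headCase r a | headCase r b
  ... | matches refl | matches refl rewrite delete-here r (r ∷ t) = just ε
  ... | matches refl | passes b≢r cb rewrite delete-past r b (r ∷ t) b≢r cb | delete-here r t | delete-here r (b ∷ t) = just ε
  ... | matches refl | blocks _ bb = ⊥-elim (commute-blocked (Commute-sym c) bb)
  ... | passes a≢r ca | matches refl rewrite delete-past r a (r ∷ t) a≢r ca | delete-here r t | delete-here r (a ∷ t) = just ε
  ... | blocks _ ba | matches refl = ⊥-elim (commute-blocked c ba)
  ... | passes a≢r ca | passes b≢r cb
    rewrite delete-past r a (b ∷ t) a≢r ca | delete-past r b (a ∷ t) b≢r cb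
          | delete-past r a t a≢r ca | delete-past r b t b≢r cb with delete r t
  ...   | nothing = nothing
  ...   | just _  = just (here c ◅ ε)
  delete-swap r (here {a} {b} {t} c) | passes a≢r ca | blocks b≢r bb
    rewrite delete-past r a (b ∷ t) a≢r ca | delete-blocked r b (a ∷ t) b≢r bb | delete-blocked r b t b≢r bb = nothing
  delete-swap r (here {a} {b} {t} c) | blocks a≢r ba | passes b≢r cb
    rewrite delete-past r b (a ∷ t) b≢r cb | delete-blocked r a (b ∷ t) a≢r ba | delete-blocked r a t a≢r ba = nothing
  delete-swap r (here {a} {b} {t} c) | blocks a≢r ba | blocks b≢r bb
    rewrite delete-blocked r b (a ∷ t) b≢r bb | delete-blocked r a (b ∷ t) a≢r ba = nothing
  delete-swap r (there {h} {t} {t′} s) with headCase r h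
  ... | matches refl rewrite delete-here r t | delete-here r t′ = just (s ◅ ε)
  ... | passes h≢r c rewrite delete-past r h t h≢r c | delete-past r h t′ h≢r c = map-∷-resp h (delete-swap r s)
  ... | blocks h≢r b rewrite delete-blocked r h t h≢r b | delete-blocked r h t′ h≢r b = nothing

  act-swap : ∀ r {x y} → Swap x y → act r x ∼ act r y
  act-swap r {x} {y} s with delete r x | delete r y | delete-swap r s
  ... | just _  | just _  | just p  = p
  ... | nothing | nothing | nothing = there s ◅ ε

  act-resp-∼ : ∀ r {x y} → x ∼ y → act r x ∼ act r y
  act-resp-∼ r ε       = ε
  act-resp-∼ r (s ◅ p) = act-swap r s ◅◅ act-resp-∼ r p

  delete-just : ∀ r x {y} → delete r x ≡ just y → (r ∷ y) ∼ x
  delete-just r (h ∷ t) e with headCase r h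
  ... | matches refl rewrite delete-here r t with refl ← e = ε
  ... | passes h≢r c rewrite delete-past r h t h≢r c with delete r t in e′ | e
  ...   | just z | refl = here (Commute-sym c) ◅ ∼-∷ h (delete-just r t e′)
  delete-just r (h ∷ t) e | blocks h≢r b rewrite delete-blocked r h t h≢r b with () ← e

  delete-twice : ∀ r x {y} → Reduced x → delete r x ≡ just y → delete r y ≡ nothing
  delete-twice r (h ∷ t) (rt , nt) e with headCase r h
  ... | matches refl rewrite delete-here r t with refl ← e = nt
  ... | passes h≢r c rewrite delete-past r h t h≢r c with delete r t in e′ | e
  ...   | just z | refl rewrite delete-past r h z h≢r c | delete-twice r t rt e′ = refl
  delete-twice r (h ∷ t) _ e | blocks h≢r b rewrite delete-blocked r h t h≢r b with () ← e

  map-∷-nothing : ∀ h {m : Maybe (List A)} → Maybe.map (h ∷_) m ≡ nothing → m ≡ nothing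
  map-∷-nothing h {nothing} _ = refl

  delete-other-nothing : ∀ r s x {y} → s ≢ r → Commute s r →
    delete r x ≡ nothing → delete s x ≡ just y → delete r y ≡ nothing
  delete-other-nothing r s (h ∷ t) s≢r c e₁ e₂ with headCase s h | headCase r h
  ... | matches refl | matches refl = ⊥-elim (s≢r refl)
  ... | matches refl | passes _ _ rewrite delete-here s t | delete-past r s t s≢r c with refl ← e₂
    = map-∷-nothing s e₁
  ... | matches refl | blocks _ b = ⊥-elim (commute-blocked c b)
  ... | passes _ _ | matches refl rewrite delete-here r t with () ← e₁
  ... | passes hs cs | passes hr cr rewrite delete-past s h t hs cs | delete-past r h t hr cr
    with delete s t in e₃ | e₂
  ...   | just z | refl rewrite delete-past r h z hr cr
    | delete-other-nothing r s t s≢r c (map-∷-nothing h e₁) e₃ = refl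
  delete-other-nothing r s (h ∷ t) s≢r c e₁ e₂ | passes hs cs | blocks hr br
    rewrite delete-past s h t hs cs with delete s t | e₂
  ... | just z | refl = delete-blocked r h z hr br
  delete-other-nothing r s (h ∷ t) s≢r c e₁ e₂ | blocks hs bs | _
    rewrite delete-blocked s h t hs bs with () ← e₂

  Reduced-delete : ∀ r x {y} → Reduced x → delete r x ≡ just y → Reduced y
  Reduced-delete r (h ∷ t) (rt , nt) e with headCase r h
  ... | matches refl rewrite delete-here r t with refl ← e = rt
  ... | passes h≢r c rewrite delete-past r h t h≢r c with delete r t in e′ | e
  ...   | just z | refl =
    Reduced-delete r t rt e′ , delete-other-nothing h r t (≢-sym h≢r) (Commute-sym c) nt e′
  Reduced-delete r (h ∷ t) _ e | blocks h≢r b rewrite delete-blocked r h t h≢r b with () ← e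

  Reduced-act : ∀ r x → Reduced x → Reduced (act r x)
  Reduced-act r x rx with delete r x in e
  ... | nothing = rx , e
  ... | just y  = Reduced-delete r x rx e

  act-involutive : ∀ r x → Reduced x → act r (act r x) ∼ x
  act-involutive r x rx with delete r x in e
  ... | nothing rewrite delete-here r x = ε
  ... | just y rewrite delete-twice r x rx e = delete-just r x e

  delete-other-just : ∀ r s x {y z} → s ≢ r → Commute s r → delete s x ≡ just y → delete r x ≡ just z →
    Σ[ w ∈ List A ] delete r y ≡ just w × delete s z ≡ just w
  delete-other-just r s (h ∷ t) s≢r c e₁ e₂ with headCase s h | headCase r h
  ... | matches refl | matches refl = ⊥-elim (s≢r refl)
  ... | matches refl | passes _ _ rewrite delete-here s t | delete-past r s t s≢r c
    with refl ← e₁ | delete r t | e₂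
  ...   | just w | refl = w , refl , delete-here s w
  delete-other-just r s (h ∷ t) s≢r c e₁ e₂ | matches refl | blocks _ b = ⊥-elim (commute-blocked c b)
  delete-other-just r s (h ∷ t) s≢r c e₁ e₂ | passes hs cs | matches refl
    rewrite delete-here r t | delete-past s r t hs cs with refl ← e₂ | delete s t | e₁
  ... | just w | refl = w , delete-here r w , refl
  delete-other-just r s (h ∷ t) s≢r c e₁ e₂ | passes hs cs | passes hr cr
    rewrite delete-past s h t hs cs | delete-past r h t hr cr
    with delete s t in e₃ | e₁
  ... | just y′ | refl with delete r t in e₄ | e₂
  ...   | just z′ | refl with delete-other-just r s t s≢r c e₃ e₄
  ...     | w , e₅ , e₆ rewrite delete-past r h y′ hr cr | delete-past s h z′ hs cs | e₅ | e₆ = h ∷ w , refl , refl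
  delete-other-just r s (h ∷ t) s≢r c e₁ e₂ | passes _ _ | blocks hr br
    rewrite delete-blocked r h t hr br with () ← e₂
  delete-other-just r s (h ∷ t) s≢r c e₁ e₂ | blocks hs bs | _
    rewrite delete-blocked s h t hs bs with () ← e₁

  act-comm : ∀ r s x → Commute r s → act r (act s x) ∼ act s (act r x)
  act-comm r s x c with r ≟ s
  ... | yes refl = ε
  ... | no r≢s with delete s x in es | delete r x in er
  ...   | nothing | nothing
    rewrite delete-past r s x (≢-sym r≢s) (Commute-sym c) | er | delete-past s r x r≢s c | es = here c ◅ ε
  ...   | just y | nothing
    rewrite delete-other-nothing r s x (≢-sym r≢s) (Commute-sym c) er es
          | delete-past s r x r≢s c | es = ε
  ...   | nothing | just z
    rewrite delete-other-nothing s r x r≢s c es er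
          | delete-past r s x (≢-sym r≢s) (Commute-sym c) | er = ε
  ...   | just y | just z with delete-other-just r s x (≢-sym r≢s) (Commute-sym c) es er
  ...     | w , e₁ , e₂ rewrite e₁ | e₂ = ε

module IntervalReflection where

  inside : ℕ → ℕ → ℕ → Bool
  inside p q y with p ≤? y | y ≤? q
  ... | yes _ | yes _ = true
  ... | _     | _     = false

  reflect : ℕ → ℕ → ℕ → ℕ
  reflect p q y = if inside p q y then p + q ∸ y else y

  inside-true : ∀ {p q y} → p ≤ y → y ≤ q → inside p q y ≡ true
  inside-true {p} {q} {y} p≤y y≤q with p ≤? y | y ≤? q
  ... | yes _ | yes _   = refl
  ... | no p≰y | _      = ⊥-elim (p≰y p≤y)
  ... | yes _ | no y≰q  = ⊥-elim (y≰q y≤q)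

  inside-false-below : ∀ {p q y} → y < p → inside p q y ≡ false
  inside-false-below {p} {q} {y} y<p with p ≤? y
  ... | yes p≤y = ⊥-elim (<⇒≱ y<p p≤y)
  ... | no _    = refl

  inside-false-above : ∀ {p q y} → q < y → inside p q y ≡ false
  inside-false-above {p} {q} {y} q<y with p ≤? y | y ≤? q
  ... | yes _ | yes y≤q = ⊥-elim (<⇒≱ q<y y≤q)
  ... | yes _ | no _    = refl
  ... | no _  | _       = refl

  inside-true⁻¹ : ∀ {p q y} → inside p q y ≡ true → p ≤ y × y ≤ q
  inside-true⁻¹ {p} {q} {y} e with p ≤? y | y ≤? q
  ... | yes p≤y | yes y≤q = p≤y , y≤q

  inside-false⁻¹ : ∀ {p q y} → inside p q y ≡ false → y < p ⊎ q < y
  inside-false⁻¹ {p} {q} {y} e with p ≤? y | y ≤? q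
  ... | yes _ | no y≰q = inj₂ (≰⇒> y≰q)
  ... | no p≰y | _     = inj₁ (≰⇒> p≰y)

  reflect-inside : ∀ {p q y} → inside p q y ≡ true → reflect p q y ≡ p + q ∸ y
  reflect-inside e rewrite e = refl

  reflect-outside : ∀ {p q y} → inside p q y ≡ false → reflect p q y ≡ y
  reflect-outside e rewrite e = refl

  ≤-from-sum : ∀ {a b c d} → a + b ≡ c + d → b ≤ d → c ≤ a
  ≤-from-sum {a} {b} {c} {d} e b≤d = +-cancelʳ-≤ b c a (subst (c + b ≤_) (sym e) (+-monoʳ-≤ c b≤d))

  <-from-sum : ∀ {a b c d} → a + b ≡ c + d → b < d → c < a
  <-from-sum {a} {b} {c} {d} e b<d = +-cancelʳ-< b c a (subst (c + b <_) (sym e) (+-monoʳ-< c b<d))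

  ∸-from-sum : ∀ {a b s} → a + b ≡ s → s ∸ a ≡ b
  ∸-from-sum {a} {b} refl = m+n∸m≡n a b

  mirror-inside : ∀ {p q y} → inside p q y ≡ true →
    (p + q ∸ y) + y ≡ p + q × p ≤ p + q ∸ y × p + q ∸ y ≤ q
  mirror-inside {p} {q} {y} e with inside-true⁻¹ e
  ... | p≤y , y≤q = sum , ≤-from-sum sum y≤q , ≤-from-sum (trans (+-comm q p) (sym sum)) p≤y
    where
    sum : (p + q ∸ y) + y ≡ p + q
    sum = m∸n+n≡m (≤-trans y≤q (m≤n+m q p))

  inside-mirror : ∀ {p q y} → inside p q y ≡ true → inside p q (p + q ∸ y) ≡ true
  inside-mirror e with mirror-inside e
  ... | _ , p≤y* , y*≤q = inside-true p≤y* y*≤q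

  reflect-involutive : ∀ p q y → reflect p q (reflect p q y) ≡ y
  reflect-involutive p q y with inside p q y in e
  ... | false rewrite e = refl
  ... | true rewrite inside-mirror e =
    ∸-from-sum (proj₁ (mirror-inside e))

  inside-reflect : ∀ p q y → inside p q (reflect p q y) ≡ inside p q y
  inside-reflect p q y with inside p q y in e
  ... | false rewrite e = refl
  ... | true = inside-mirror e

  reflect-bounded : ∀ {p q n y} → 1 ≤ p → q ≤ n → 1 ≤ y → y ≤ n → 1 ≤ reflect p q y × reflect p q y ≤ n
  reflect-bounded {p} {q} {n} {y} 1≤p q≤n 1≤y y≤n with inside p q y in e
  ... | false = 1≤y , y≤n
  ... | true with mirror-inside e
  ...   | _ , p≤y* , y*≤q = ≤-trans 1≤p p≤y* , ≤-trans y*≤q q≤n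

  Apart : ℕ → ℕ → ℕ → ℕ → Set
  Apart p q m r = q < m ⊎ r < p

  Apart-sym : ∀ {p q m r} → Apart p q m r → Apart m r p q
  Apart-sym (inj₁ q<m) = inj₂ q<m
  Apart-sym (inj₂ r<p) = inj₁ r<p

  inside-apart : ∀ {p q m r y} → inside p q y ≡ true → Apart p q m r → inside m r y ≡ false
  inside-apart e (inj₁ q<m) = inside-false-below (≤-<-trans (proj₂ (inside-true⁻¹ e)) q<m)
  inside-apart e (inj₂ r<p) = inside-false-above (<-≤-trans r<p (proj₁ (inside-true⁻¹ e)))

  inside-reflect-apart : ∀ {p q m r} y → Apart p q m r → inside m r (reflect p q y) ≡ inside m r y
  inside-reflect-apart {p} {q} y ap with inside p q y in e
  ... | true  = trans (inside-apart (inside-mirror e) ap) (sym (inside-apart e ap))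
  ... | false = refl

  reflect-comm-apart : ∀ {p q m r} y → Apart p q m r → reflect p q (reflect m r y) ≡ reflect m r (reflect p q y)
  reflect-comm-apart {p} {q} {m} {r} y ap with inside p q y in e₁
  ... | true rewrite reflect-outside (inside-apart e₁ ap) | reflect-inside e₁
                   | reflect-outside (inside-apart (inside-mirror e₁) ap) = refl
  ... | false with inside m r y in e₂
  ...   | true  = reflect-outside (inside-apart (inside-mirror e₂) (Apart-sym ap))
  ...   | false = reflect-outside e₁

  Within : ℕ → ℕ → ℕ → ℕ → Set
  Within m r p q = p ≤ m × r ≤ q

  Mirror : (p q m r m′ r′ : ℕ) → Set
  Mirror p q m r m′ r′ = m′ + r ≡ p + q × r′ + m ≡ p + q

  Mirror-sym : ∀ {p q m r m′ r′} → Mirror p q m r m′ r′ → Mirror p q m′ r′ m r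
  Mirror-sym {m = m} {r} {m′} {r′} (e₁ , e₂) = trans (+-comm m r′) e₂ , trans (+-comm r m′) e₁

  Mirror-within : ∀ {p q m r m′ r′} → Within m r p q → Mirror p q m r m′ r′ → Within m′ r′ p q
  Mirror-within {p} {q} (p≤m , r≤q) (e₁ , e₂) = ≤-from-sum e₁ r≤q , ≤-from-sum (trans (+-comm q p) (sym e₂)) p≤m

  inside-within : ∀ {p q m r y} → Within m r p q → inside m r y ≡ true → inside p q y ≡ true
  inside-within (p≤m , r≤q) e with inside-true⁻¹ e
  ... | m≤y , y≤r = inside-true (≤-trans p≤m m≤y) (≤-trans y≤r r≤q)

  outside-within : ∀ {p q m r y} → Within m r p q → inside p q y ≡ false → inside m r y ≡ false
  outside-within {m = m} {r} {y} w e with inside m r y in e′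
  ... | false = refl
  ... | true with () ← trans (sym (inside-within w e′)) e

  inside-reflect-within : ∀ {p q m r} y → Within m r p q → inside p q (reflect m r y) ≡ inside p q y
  inside-reflect-within {m = m} {r} y w with inside m r y in e
  ... | true  = trans (inside-within w (inside-mirror e)) (sym (inside-within w e))
  ... | false = refl

  inside-mirrored : ∀ {p q m r m′ r′ y} → Within m r p q → Mirror p q m r m′ r′ →
    inside p q y ≡ true → inside m r (p + q ∸ y) ≡ inside m′ r′ y
  inside-mirrored {p} {q} {m} {r} {m′} {r′} {y} w (e₁ , e₂) ea
    with mirror-inside ea | inside m′ r′ y in ec
  ... | sum , _ , _ | true with inside-true⁻¹ ec
  ...   | m′≤y , y≤r′ = inside-true (≤-from-sum (trans sum (trans (sym e₂) (+-comm r′ m))) y≤r′)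
                                    (≤-from-sum (trans (+-comm r m′) (trans e₁ (sym sum))) m′≤y)
  inside-mirrored {p} {q} {m} {r} {m′} {r′} {y} w (e₁ , e₂) ea | sum , _ , _ | false
    with inside-false⁻¹ ec
  ... | inj₁ y<m′ = inside-false-above (<-from-sum (trans sum (trans (sym e₁) (+-comm m′ r))) y<m′)
  ... | inj₂ r′<y = inside-false-below (<-from-sum (trans (+-comm m r′) (trans e₂ (sym sum))) r′<y)

  inside-reflect-mirror : ∀ {p q m r m′ r′} y → Within m r p q → Mirror p q m r m′ r′ →
    inside m r (reflect p q y) ≡ inside m′ r′ y
  inside-reflect-mirror {p} {q} y w mir with inside p q y in ea
  ... | false = trans (outside-within w ea) (sym (outside-within (Mirror-within w mir) ea))
  ... | true  = inside-mirrored w mir ea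

  -- The additive identity behind reflect-conjugate, free of truncated subtraction.
  mirror-arithmetic : ∀ {p q m r m′ r′} v w y* y z → Mirror p q m r m′ r′ →
    v + y* ≡ m + r → y* + y ≡ p + q → w + z ≡ p + q → z + y ≡ m′ + r′ → v ≡ w
  mirror-arithmetic {p} {q} {m} {r} {m′} {r′} v w y* y z (e₁ , e₂) h₁ h₂ h₃ h₄ =
    +-cancelʳ-≡ (p + q) v w (+-cancelʳ-≡ (p + q) (v + (p + q)) (w + (p + q)) (begin
      v + (p + q) + (p + q)      ≡⟨ cong (λ t → v + t + (p + q)) (sym h₂) ⟩
      v + (y* + y) + (p + q)     ≡⟨ cong (v + (y* + y) +_) (sym h₃) ⟩
      v + (y* + y) + (w + z)     ≡⟨ regroup₁ v y* y w z ⟩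
      (v + y*) + (w + (z + y))   ≡⟨ cong₂ (λ s t → s + (w + t)) h₁ h₄ ⟩
      (m + r) + (w + (m′ + r′))  ≡⟨ regroup₂ m r w m′ r′ ⟩
      w + (m′ + r) + (r′ + m)    ≡⟨ cong₂ (λ s t → w + s + t) e₁ e₂ ⟩
      w + (p + q) + (p + q)      ∎))
    where
    open ≡-Reasoning
    regroup₁ : ∀ v y* y w z → v + (y* + y) + (w + z) ≡ (v + y*) + (w + (z + y))
    regroup₁ = solve-∀
    regroup₂ : ∀ m r w m′ r′ → (m + r) + (w + (m′ + r′)) ≡ w + (m′ + r) + (r′ + m)
    regroup₂ = solve-∀

  reflect-conjugate : ∀ {p q m r m′ r′} y → Within m r p q → Mirror p q m r m′ r′ →
    reflect m r (reflect p q y) ≡ reflect p q (reflect m′ r′ y)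
  reflect-conjugate {p} {q} {m} {r} {m′} {r′} y w mir with inside p q y in ea
  ... | false rewrite reflect-outside (outside-within w ea)
                    | reflect-outside (outside-within (Mirror-within w mir) ea) | reflect-outside ea = refl
  ... | true with inside m′ r′ y in ec
  ...   | false rewrite reflect-outside (trans (inside-mirrored w mir ea) ec) | reflect-inside ea = refl
  ...   | true rewrite reflect-inside (trans (inside-mirrored w mir ea) ec)
                   | reflect-inside (inside-within (Mirror-within w mir) (inside-mirror ec)) =
    mirror-arithmetic {p} {q} {m} {r} {m′} {r′} (m + r ∸ y*) (p + q ∸ z) y* y z mir
      (m∸n+n≡m (≤-trans (proj₂ (inside-true⁻¹ y*-inside)) (m≤n+m r m)))
      (proj₁ (mirror-inside ea))
      (m∸n+n≡m (≤-trans (proj₂ (inside-true⁻¹ z-inside)) (m≤n+m q p)))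
      (proj₁ (mirror-inside ec))
    where
    y* = p + q ∸ y
    z = m′ + r′ ∸ y
    y*-inside : inside m r y* ≡ true
    y*-inside = trans (inside-mirrored w mir ea) ec
    z-inside : inside p q z ≡ true
    z-inside = inside-within (Mirror-within w mir) (inside-mirror ec)

module IndicatorVectors where

  -- The subset {y ∈ [1, k] ∣ f y}, listed from y = k down to y = 1.
  indicator : (ℕ → Bool) → ℕ → List Bool
  indicator f zero    = []
  indicator f (suc k) = f (suc k) ∷ indicator f k

  _⊆ᵇ_ : List Bool → List Bool → Bool
  (x ∷ xs) ⊆ᵇ (y ∷ ys) = (not x ∨ y) ∧ (xs ⊆ᵇ ys)
  _        ⊆ᵇ _        = true

  disjointᵇ : List Bool → List Bool → Bool
  disjointᵇ (x ∷ xs) (y ∷ ys) = not (x ∧ y) ∧ disjointᵇ xs ys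
  disjointᵇ _        _        = true

  nestedOrDisjoint : List Bool → List Bool → Bool
  nestedOrDisjoint A B = (A ⊆ᵇ B) ∨ ((B ⊆ᵇ A) ∨ disjointᵇ A B)

  disjointᵇ-sym : ∀ A B → disjointᵇ A B ≡ disjointᵇ B A
  disjointᵇ-sym []      []      = refl
  disjointᵇ-sym []      (_ ∷ _) = refl
  disjointᵇ-sym (_ ∷ _) []      = refl
  disjointᵇ-sym (x ∷ A) (y ∷ B) rewrite disjointᵇ-sym A B | ∧-comm x y = refl

  nestedOrDisjoint-sym : ∀ A B → nestedOrDisjoint A B ≡ nestedOrDisjoint B A
  nestedOrDisjoint-sym A B rewrite disjointᵇ-sym A B with A ⊆ᵇ B | B ⊆ᵇ A
  ... | true  | true  = refl
  ... | true  | false = refl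
  ... | false | true  = refl
  ... | false | false = refl

  nestedOrDisjoint-cases : ∀ A B → nestedOrDisjoint A B ≡ true →
    (A ⊆ᵇ B) ≡ true ⊎ (B ⊆ᵇ A) ≡ true ⊎ disjointᵇ A B ≡ true
  nestedOrDisjoint-cases A B e with A ⊆ᵇ B | B ⊆ᵇ A | disjointᵇ A B
  ... | true  | _     | _    = inj₁ refl
  ... | false | true  | _    = inj₂ (inj₁ refl)
  ... | false | false | true = inj₂ (inj₂ refl)

  ⊆ᵇ⇒nestedOrDisjoint : ∀ A B → (A ⊆ᵇ B) ≡ true → nestedOrDisjoint A B ≡ true
  ⊆ᵇ⇒nestedOrDisjoint A B e rewrite e = refl

  disjointᵇ⇒nestedOrDisjoint : ∀ A B → disjointᵇ A B ≡ true → nestedOrDisjoint A B ≡ true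
  disjointᵇ⇒nestedOrDisjoint A B e with A ⊆ᵇ B | B ⊆ᵇ A
  ... | true  | _     = refl
  ... | false | true  = refl
  ... | false | false = e

  indicator-cong : ∀ {f g} k → (∀ y → f y ≡ g y) → indicator f k ≡ indicator g k
  indicator-cong zero    f≗g = refl
  indicator-cong (suc k) f≗g = cong₂ _∷_ (f≗g (suc k)) (indicator-cong k f≗g)

  indicator-⊆ : ∀ {f g} k → (∀ y → f y ≡ true → g y ≡ true) → (indicator f k ⊆ᵇ indicator g k) ≡ true
  indicator-⊆ zero f⊆g = refl
  indicator-⊆ {f} (suc k) f⊆g with f (suc k) in e
  ... | true rewrite f⊆g (suc k) e = indicator-⊆ k f⊆g
  ... | false = indicator-⊆ k f⊆g

  indicator-disjoint : ∀ {f g} k → (∀ y → f y ≡ true → g y ≡ false) →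
    disjointᵇ (indicator f k) (indicator g k) ≡ true
  indicator-disjoint zero f∩g = refl
  indicator-disjoint {f} (suc k) f∩g with f (suc k) in e
  ... | true rewrite f∩g (suc k) e = indicator-disjoint k f∩g
  ... | false = indicator-disjoint k f∩g

  ≤-pred-≢ : ∀ {y k} → y ≤ suc k → y ≢ suc k → y ≤ k
  ≤-pred-≢ y≤1+k y≢1+k = ≤-pred (≤∧≢⇒< y≤1+k y≢1+k)

  ∧-true-left : ∀ {a b} → a ∧ b ≡ true → a ≡ true
  ∧-true-left {true} _ = refl

  ∧-true-right : ∀ {a b} → a ∧ b ≡ true → b ≡ true
  ∧-true-right {true} e = e

  indicator-⊆⁻¹ : ∀ {f g} k → (indicator f k ⊆ᵇ indicator g k) ≡ true →
    ∀ y → 1 ≤ y → y ≤ k → f y ≡ true → g y ≡ true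
  indicator-⊆⁻¹ zero _ y 1≤y y≤0 = ⊥-elim (<⇒≱ 1≤y y≤0)
  indicator-⊆⁻¹ {f} {g} (suc k) e y 1≤y y≤k fy with y ℕ.≟ suc k
  ... | yes refl rewrite fy = ∧-true-left e
  ... | no y≢1+k = indicator-⊆⁻¹ k (∧-true-right {not (f (suc k)) ∨ g (suc k)} e) y 1≤y (≤-pred-≢ y≤k y≢1+k) fy

  indicator-disjoint⁻¹ : ∀ {f g} k → disjointᵇ (indicator f k) (indicator g k) ≡ true →
    ∀ y → 1 ≤ y → y ≤ k → f y ≡ true → g y ≡ false
  indicator-disjoint⁻¹ zero _ y 1≤y y≤0 = ⊥-elim (<⇒≱ 1≤y y≤0)
  indicator-disjoint⁻¹ {f} {g} (suc k) e y 1≤y y≤k fy with y ℕ.≟ suc k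
  ... | yes refl rewrite fy with g (suc k) | ∧-true-left {not (g (suc k))} e
  ...   | false | _ = refl
  indicator-disjoint⁻¹ {f} {g} (suc k) e y 1≤y y≤k fy | no y≢1+k =
    indicator-disjoint⁻¹ k (∧-true-right {not (f (suc k) ∧ g (suc k))} e) y 1≤y (≤-pred-≢ y≤k y≢1+k) fy

  indicator-injective : ∀ {f g} k → indicator f k ≡ indicator g k → ∀ y → 1 ≤ y → y ≤ k → f y ≡ g y
  indicator-injective zero _ y 1≤y y≤0 = ⊥-elim (<⇒≱ 1≤y y≤0)
  indicator-injective (suc k) e y 1≤y y≤k with y ℕ.≟ suc k
  ... | yes refl = List.∷-injectiveˡ e
  ... | no y≢1+k = indicator-injective k (List.∷-injectiveʳ e) y 1≤y (≤-pred-≢ y≤k y≢1+k)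

-- A state (τ , x) pairs a permutation τ of [1, n] with a word x, as in ReducedWords, of
-- the right-angled Coxeter group on subsets of [1, n]; s_g acts on the right by
-- (τ , x) ↦ (perm g ∘ τ , x · τ⁻¹(g)), where perm g reverses the interval g.
module CactusAction (n : ℕ) where

  open IntervalReflection
  open IndicatorVectors
  open ReducedWords (List.≡-dec Bool._≟_) nestedOrDisjoint nestedOrDisjoint-sym public

  Label : Set
  Label = List Bool

  perm : Gen n → ℕ → ℕ
  perm g = reflect (lo g) (hi g)

  insideGen : Gen n → ℕ → Bool
  insideGen g = inside (lo g) (hi g)

  inside-perm-apart : ∀ {a b} → Disjoint a b → ∀ y → insideGen b (perm a y) ≡ insideGen b y
  inside-perm-apart {a} {b} d y = inside-reflect-apart {lo a} {hi a} {lo b} {hi b} y d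

  perm-comm-apart : ∀ {a b} → Disjoint a b → ∀ y → perm a (perm b y) ≡ perm b (perm a y)
  perm-comm-apart {a} {b} d y = reflect-comm-apart {lo a} {hi a} {lo b} {hi b} y d

  inside-perm-within : ∀ {a c} → Contained c a → ∀ y → insideGen a (perm c y) ≡ insideGen a y
  inside-perm-within {a} {c} w y = inside-reflect-within {lo a} {hi a} {lo c} {hi c} y w

  inside-perm-mirror : ∀ {a b c} → Contained b a → Reflection a b c → ∀ y →
    insideGen b (perm a y) ≡ insideGen c y
  inside-perm-mirror {a} {b} {c} w mir y =
    inside-reflect-mirror {lo a} {hi a} {lo b} {hi b} {lo c} {hi c} y w mir

  perm-conjugate : ∀ {a b c} → Contained b a → Reflection a b c → ∀ y →
    perm b (perm a y) ≡ perm a (perm c y)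
  perm-conjugate {a} {b} {c} w mir y = reflect-conjugate {lo a} {hi a} {lo b} {hi b} {lo c} {hi c} y w mir

  Reflection-contained : ∀ {a b c : Gen n} → Contained b a → Reflection a b c → Contained c a
  Reflection-contained {a} {b} {c} = Mirror-within {lo a} {hi a} {lo b} {hi b} {lo c} {hi c}

  label : (ℕ → ℕ) → Gen n → Label
  label τ g = indicator (λ y → insideGen g (τ y)) n

  label-cong : ∀ {τ τ′} g → (∀ y → τ y ≡ τ′ y) → label τ g ≡ label τ′ g
  label-cong g τ≗τ′ = indicator-cong n (λ y → cong (insideGen g) (τ≗τ′ y))

  label-perm : ∀ τ a b c → (∀ y → insideGen b (perm a y) ≡ insideGen c y) → label (perm a ∘ τ) b ≡ label τ c
  label-perm τ a b c h = indicator-cong n (h ∘ τ)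

  label-commute-within : ∀ τ {a c} → Contained c a → Commute (label τ c) (label τ a)
  label-commute-within τ {a} {c} c⊆a =
    ⊆ᵇ⇒nestedOrDisjoint (label τ c) (label τ a)
      (indicator-⊆ {λ y → insideGen c (τ y)} {λ y → insideGen a (τ y)} n (λ y → inside-within c⊆a))

  label-commute-apart : ∀ τ {a b} → Disjoint a b → Commute (label τ a) (label τ b)
  label-commute-apart τ {a} {b} d =
    disjointᵇ⇒nestedOrDisjoint (label τ a) (label τ b)
      (indicator-disjoint {λ y → insideGen a (τ y)} {λ y → insideGen b (τ y)} n (λ y e → inside-apart e d))

  generator : Letter (Gen n) → Gen n
  generator (pos g) = g
  generator (neg g) = g

  State : Set
  State = (ℕ → ℕ) × List Label

  step : State → Gen n → State
  step (τ , x) g = perm g ∘ τ , act (label τ g) x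

  run : State → Word (Gen n) → State
  run s []      = s
  run s (l ∷ w) = run (step s (generator l)) w

  run-++ : ∀ s u v → run s (u ++ v) ≡ run (run s u) v
  run-++ s []      v = refl
  run-++ s (l ∷ u) v = run-++ (step s (generator l)) u v

  _≋_ : State → State → Set
  (τ , x) ≋ (τ′ , x′) = (∀ y → τ y ≡ τ′ y) × x ∼ x′

  ≋-sym : ∀ {s t} → s ≋ t → t ≋ s
  ≋-sym (τ≗τ′ , x∼x′) = (λ y → sym (τ≗τ′ y)) , ∼-sym x∼x′

  ≋-trans : ∀ {s t u} → s ≋ t → t ≋ u → s ≋ u
  ≋-trans (τ≗τ′ , x∼x′) (τ′≗τ″ , x′∼x″) = (λ y → trans (τ≗τ′ y) (τ′≗τ″ y)) , (x∼x′ ◅◅ x′∼x″)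

  step-resp-≋ : ∀ {s t} g → s ≋ t → step s g ≋ step t g
  step-resp-≋ {τ , x} {τ′ , x′} g (τ≗τ′ , x∼x′) =
    (λ y → cong (perm g) (τ≗τ′ y)) ,
    subst (λ L → act (label τ g) x ∼ act L x′) (label-cong g τ≗τ′) (act-resp-∼ (label τ g) x∼x′)

  run-resp-≋ : ∀ {s t} w → s ≋ t → run s w ≋ run t w
  run-resp-≋ []      s≋t = s≋t
  run-resp-≋ (l ∷ w) s≋t = run-resp-≋ w (step-resp-≋ (generator l) s≋t)

  ReducedState : State → Set
  ReducedState (_ , x) = Reduced x

  run-reduced : ∀ s w → ReducedState s → ReducedState (run s w)
  run-reduced s       []      r = r
  run-reduced (τ , x) (l ∷ w) r = run-reduced (step (τ , x) (generator l)) w (Reduced-act (label τ (generator l)) x r)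

  step-involutive : ∀ g s → ReducedState s → step (step s g) g ≋ s
  step-involutive g (τ , x) r =
    (λ y → reflect-involutive (lo g) (hi g) (τ y)) ,
    subst (λ L → act L (act (label τ g) x) ∼ x)
          (sym (label-perm τ g g g (inside-reflect (lo g) (hi g))))
          (act-involutive (label τ g) x r)

  step-comm-apart : ∀ {a b} s → Disjoint a b → step (step s a) b ≋ step (step s b) a
  step-comm-apart {a} {b} (τ , x) d =
    (λ y → perm-comm-apart {b} {a} (Apart-sym d) (τ y)) ,
    subst₂ (λ L M → act L (act (label τ a) x) ∼ act M (act (label τ b) x))
      (sym (label-perm τ a b b (inside-perm-apart {a} {b} d)))
      (sym (label-perm τ b a a (inside-perm-apart {b} {a} (Apart-sym d))))
      (act-comm (label τ b) (label τ a) x (label-commute-apart τ {b} {a} (Apart-sym d)))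

  step-conjugate : ∀ {a b c} s → Contained b a → Reflection a b c → step (step s a) b ≋ step (step s c) a
  step-conjugate {a} {b} {c} (τ , x) w mir =
    (λ y → perm-conjugate {a} {b} {c} w mir (τ y)) ,
    subst₂ (λ L M → act L (act (label τ a) x) ∼ act M (act (label τ c) x))
      (sym (label-perm τ a b c (inside-perm-mirror {a} {b} {c} w mir)))
      (sym (label-perm τ c a a (inside-perm-within {a} {c} c⊆a)))
      (act-comm (label τ c) (label τ a) x (label-commute-within τ {a} {c} c⊆a))
    where
    c⊆a = Reflection-contained {a} {b} {c} w mir

  run-resp-≈ : ∀ {u v} → CactusRel n ⊢ u ≈ v → ∀ s → ReducedState s → run s u ≋ run s v
  run-resp-≈ ≈-refl              s r = (λ _ → refl) , ε
  run-resp-≈ (≈-sym p)           s r = ≋-sym (run-resp-≈ p s r)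
  run-resp-≈ (≈-trans p q)       s r = ≋-trans (run-resp-≈ p s r) (run-resp-≈ q s r)
  run-resp-≈ (≈-cong {u} {v} a b p) s r =
    subst₂ _≋_ (sym (run-++-++ u)) (sym (run-++-++ v))
      (run-resp-≋ b (run-resp-≈ p (run s a) (run-reduced s a r)))
    where
    run-++-++ : ∀ w → run s (a ++ w ++ b) ≡ run (run (run s a) w) b
    run-++-++ w = trans (run-++ s a (w ++ b)) (run-++ (run s a) w b)
  run-resp-≈ (≈-cancel (pos g))   s r = step-involutive g s r
  run-resp-≈ (≈-cancel (neg g))   s r = step-involutive g s r
  run-resp-≈ (≈-rel (j1 g))       s r = step-involutive g s r
  run-resp-≈ (≈-rel (j2 a b d))   s r = step-comm-apart {a} {b} s d
  run-resp-≈ (≈-rel (j3 a b c w mir)) s r = step-conjugate {a} {b} {c} s w mir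

module IntervalsFromLabels (n : ℕ) where

  open IntervalReflection
  open IndicatorVectors
  open CactusAction n

  lo≥1 : ∀ (g : Gen n) → 1 ≤ lo g
  lo≥1 (_ , 1≤p , _ , _) = 1≤p

  lo<hi : ∀ (g : Gen n) → lo g < hi g
  lo<hi (_ , _ , p<q , _) = p<q

  hi≤n : ∀ (g : Gen n) → hi g ≤ n
  hi≤n (_ , _ , _ , q≤n) = q≤n

  lo≤hi : ∀ (g : Gen n) → lo g ≤ hi g
  lo≤hi g = <⇒≤ (lo<hi g)

  lo≤n : ∀ (g : Gen n) → lo g ≤ n
  lo≤n g = ≤-trans (lo≤hi g) (hi≤n g)

  hi≥1 : ∀ (g : Gen n) → 1 ≤ hi g
  hi≥1 g = ≤-trans (lo≥1 g) (lo≤hi g)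

  Gen-≡ : ∀ {g k : Gen n} → lo g ≡ lo k → hi g ≡ hi k → g ≡ k
  Gen-≡ {(p , q) , a , b , c} {(.p , .q) , a′ , b′ , c′} refl refl
    rewrite ≤-irrelevant a a′ | <-irrelevant b b′ | ≤-irrelevant c c′ = refl

  inside-lo : ∀ (g : Gen n) → insideGen g (lo g) ≡ true
  inside-lo g = inside-true ≤-refl (lo≤hi g)

  inside-hi : ∀ (g : Gen n) → insideGen g (hi g) ≡ true
  inside-hi g = inside-true (lo≤hi g) ≤-refl

  perm-bounded : ∀ (g : Gen n) {y} → 1 ≤ y → y ≤ n → 1 ≤ perm g y × perm g y ≤ n
  perm-bounded g = reflect-bounded (lo≥1 g) (hi≤n g)

  mirror : ∀ (a b : Gen n) → Contained b a → Σ[ c ∈ Gen n ] Reflection a b c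
  mirror a b b⊆a@(_ , hb≤ha) = ((s ∸ hi b , s ∸ lo b) , 1≤c , c₁<c₂ , c₂≤n) , e₁ , e₂
    where
    s = lo a + hi a
    e₁ : (s ∸ hi b) + hi b ≡ s
    e₁ = m∸n+n≡m (≤-trans hb≤ha (m≤n+m (hi a) (lo a)))
    e₂ : (s ∸ lo b) + lo b ≡ s
    e₂ = m∸n+n≡m (≤-trans (≤-trans (lo≤hi b) hb≤ha) (m≤n+m (hi a) (lo a)))
    c⊆a = Mirror-within {lo a} {hi a} {lo b} {hi b} {s ∸ hi b} {s ∸ lo b} b⊆a (e₁ , e₂)
    1≤c = ≤-trans (lo≥1 a) (proj₁ c⊆a)
    c₁<c₂ = <-from-sum (trans e₂ (sym e₁)) (lo<hi b)
    c₂≤n = ≤-trans (proj₂ c⊆a) (hi≤n a)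

  Onto : (ℕ → ℕ) → Set
  Onto τ = ∀ y → 1 ≤ y → y ≤ n → Σ[ j ∈ ℕ ] 1 ≤ j × j ≤ n × τ j ≡ y

  Onto-id : Onto (λ y → y)
  Onto-id y 1≤y y≤n = y , 1≤y , y≤n , refl

  Onto-perm : ∀ {τ} g → Onto τ → Onto (perm g ∘ τ)
  Onto-perm g onto y 1≤y y≤n with perm-bounded g 1≤y y≤n
  ... | 1≤y′ , y′≤n with onto (perm g y) 1≤y′ y′≤n
  ...   | j , 1≤j , j≤n , τj≡y′ = j , 1≤j , j≤n , trans (cong (perm g) τj≡y′) (reflect-involutive (lo g) (hi g) y)

  Onto-∀ : ∀ {τ} → Onto τ → (P : ℕ → Set) → (∀ j → 1 ≤ j → j ≤ n → P (τ j)) → ∀ y → 1 ≤ y → y ≤ n → P y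
  Onto-∀ onto P h y 1≤y y≤n with onto y 1≤y y≤n
  ... | j , 1≤j , j≤n , refl = h j 1≤j j≤n

  Contained-pointwise : ∀ a b → (∀ t → 1 ≤ t → t ≤ n → insideGen b t ≡ true → insideGen a t ≡ true) →
    Contained b a
  Contained-pointwise a b b⊆a =
    proj₁ (inside-true⁻¹ (b⊆a (lo b) (lo≥1 b) (lo≤n b) (inside-lo b))) ,
    proj₂ (inside-true⁻¹ (b⊆a (hi b) (hi≥1 b) (hi≤n b) (inside-hi b)))

  label-injective : ∀ {τ} → Onto τ → ∀ g k → label τ g ≡ label τ k → g ≡ k
  label-injective {τ} onto g k e =
    Gen-≡ (≤-antisym (proj₁ k⊆g) (proj₁ g⊆k)) (≤-antisym (proj₂ g⊆k) (proj₂ k⊆g))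
    where
    same : ∀ y → 1 ≤ y → y ≤ n → insideGen g y ≡ insideGen k y
    same = Onto-∀ onto (λ z → insideGen g z ≡ insideGen k z) (indicator-injective n e)
    g⊆k : Contained g k
    g⊆k = Contained-pointwise k g (λ t 1≤t t≤n gt → trans (sym (same t 1≤t t≤n)) gt)
    k⊆g : Contained k g
    k⊆g = Contained-pointwise g k (λ t 1≤t t≤n kt → trans (same t 1≤t t≤n) kt)

  module _ {τ : ℕ → ℕ} (onto : Onto τ) (a b : Gen n) where

    -- The two labels compare b and a at the points τ y; since perm a fixes a setwise and
    -- τ, perm a are onto, this is a comparison at every point of [1, n].
    pointwise : ∀ (P : Bool → Bool → Set) →
      (∀ y → 1 ≤ y → y ≤ n → P (insideGen b (perm a (τ y))) (insideGen a (τ y))) →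
      ∀ t → 1 ≤ t → t ≤ n → P (insideGen b t) (insideGen a t)
    pointwise P h t 1≤t t≤n with perm-bounded a 1≤t t≤n
    ... | 1≤t′ , t′≤n =
      subst₂ P (cong (insideGen b) (reflect-involutive (lo a) (hi a) t)) (inside-reflect (lo a) (hi a) t)
        (Onto-∀ onto (λ t → P (insideGen b (perm a t)) (insideGen a t)) h (perm a t) 1≤t′ t′≤n)

    contained-from-labels : (label (perm a ∘ τ) b ⊆ᵇ label τ a) ≡ true → Contained b a
    contained-from-labels e =
      Contained-pointwise a b (pointwise (λ inB inA → inB ≡ true → inA ≡ true) (indicator-⊆⁻¹ n e))

    containing-from-labels : (label τ a ⊆ᵇ label (perm a ∘ τ) b) ≡ true → Contained a b
    containing-from-labels e =
      Contained-pointwise b a (pointwise (λ inB inA → inA ≡ true → inB ≡ true) (indicator-⊆⁻¹ n e))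

    no-common-point : disjointᵇ (label (perm a ∘ τ) b) (label τ a) ≡ true →
      ∀ t → 1 ≤ t → t ≤ n → insideGen a t ≡ true → insideGen b t ≡ true → ⊥
    no-common-point e t 1≤t t≤n ta tb
      with () ← trans (sym ta)
                  (pointwise (λ inB inA → inB ≡ true → inA ≡ false) (indicator-disjoint⁻¹ n e) t 1≤t t≤n tb)

    disjoint-from-labels : disjointᵇ (label (perm a ∘ τ) b) (label τ a) ≡ true → Disjoint a b
    disjoint-from-labels e with hi a <? lo b | hi b <? lo a
    ... | yes ha<lb | _         = inj₁ ha<lb
    ... | no _      | yes hb<la = inj₂ hb<la
    ... | no ha≮lb  | no hb≮la with lo a ≤? lo b
    ...   | yes la≤lb = ⊥-elim (no-common-point e (lo b) (lo≥1 b) (lo≤n b)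
                                  (inside-true la≤lb (≮⇒≥ ha≮lb)) (inside-lo b))
    ...   | no la≰lb  = ⊥-elim (no-common-point e (lo a) (lo≥1 a) (lo≤n a)
                                  (inside-lo a) (inside-true (<⇒≤ (≰⇒> la≰lb)) (≮⇒≥ hb≮la)))

module Completeness (n : ℕ) (C : Gen n → Set) (C-symmetric : Symmetric C) where

  open CactusAction n
  open IntervalsFromLabels n
  open IntervalReflection using (Apart-sym; Mirror-sym; inside-reflect; reflect-involutive)
  open IndicatorVectors using (nestedOrDisjoint-cases)

  CGen : Set
  CGen = Σ (Gen n) C

  _≈ᶜ_ : Word CGen → Word CGen → Set
  u ≈ᶜ v = restrict (CactusRel n) C ⊢ u ≈ v

  -- A list ws of C-generators encodes the word read from its end, so that the
  -- generator at the head is applied last.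
  word : List CGen → Word CGen
  word []       = []
  word (a ∷ ws) = word ws ++ pos a ∷ []

  permOf : List CGen → ℕ → ℕ
  permOf []       = λ y → y
  permOf (a ∷ ws) = perm (proj₁ a) ∘ permOf ws

  labels : List CGen → List Label
  labels []       = []
  labels (a ∷ ws) = label (permOf ws) (proj₁ a) ∷ labels ws

  permOf-onto : ∀ ws → Onto (permOf ws)
  permOf-onto []       = Onto-id
  permOf-onto (a ∷ ws) = Onto-perm (proj₁ a) (permOf-onto ws)

  ≈ᶜ-prefix : ∀ X {u v} → u ≈ᶜ v → (X ++ u) ≈ᶜ (X ++ v)
  ≈ᶜ-prefix X {u} {v} p =
    subst₂ _≈ᶜ_ (cong (X ++_) (List.++-identityʳ u)) (cong (X ++_) (List.++-identityʳ v)) (≈-cong X [] p)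

  ≈ᶜ-suffix : ∀ Y {u v} → u ≈ᶜ v → (u ++ Y) ≈ᶜ (v ++ Y)
  ≈ᶜ-suffix Y = ≈-cong [] Y

  word-swap : ∀ ws {a b c d : CGen} → (pos a ∷ pos b ∷ []) ≈ᶜ (pos c ∷ pos d ∷ []) →
    word (b ∷ a ∷ ws) ≈ᶜ word (d ∷ c ∷ ws)
  word-swap ws {a} {b} {c} {d} p =
    subst₂ _≈ᶜ_ (sym (List.++-assoc (word ws) _ _)) (sym (List.++-assoc (word ws) _ _)) (≈ᶜ-prefix (word ws) p)

  square-≈ᶜ : ∀ (a b : CGen) → proj₁ a ≡ proj₁ b → (pos a ∷ pos b ∷ []) ≈ᶜ []
  square-≈ᶜ a b refl = ≈-rel (j1 (proj₁ a))

  pos-≈ᶜ : ∀ (a b : CGen) → proj₁ a ≡ proj₁ b → (pos a ∷ []) ≈ᶜ (pos b ∷ [])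
  pos-≈ᶜ a b a≡b = ≈-trans (≈-cong (pos a ∷ []) [] (≈-sym (square-≈ᶜ b b refl)))
                           (≈-cong [] (pos b ∷ []) (square-≈ᶜ a b a≡b))

  neg≈ᶜpos : ∀ (a : CGen) → (neg a ∷ []) ≈ᶜ (pos a ∷ [])
  neg≈ᶜpos a = ≈-trans (≈-cong (neg a ∷ []) [] (≈-sym (square-≈ᶜ a a refl)))
                       (≈-cong [] (pos a ∷ []) (≈-cancel (neg a)))

  Realises : List CGen → State → Set
  Realises ws (τ , x) = (∀ y → permOf ws y ≡ τ y) × labels ws ≡ x

  Rewrites : List CGen → State → Set
  Rewrites ws s = Σ[ ws′ ∈ List CGen ] Realises ws′ s × word ws ≈ᶜ word ws′

  module _ (a b : CGen) (ws : List CGen) where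

    private
      a′ = proj₁ a
      b′ = proj₁ b
      τ = permOf ws
      Swapped : State
      Swapped = permOf (b ∷ a ∷ ws) , label τ a′ ∷ label (perm a′ ∘ τ) b′ ∷ labels ws

    rewrite-nested : Contained b′ a′ → Rewrites (b ∷ a ∷ ws) Swapped
    rewrite-nested b⊆a =
      (a ∷ (c , C-symmetric a′ b′ c (proj₂ a) (proj₂ b) b⊆a mir) ∷ ws) ,
      ((λ y → sym (perm-conjugate {a′} {b′} {c} b⊆a mir (τ y))) ,
       cong₂ _∷_ (label-perm τ c a′ a′ (inside-perm-within {a′} {c} c⊆a))
                 (cong (_∷ labels ws) (sym (label-perm τ a′ b′ c (inside-perm-mirror {a′} {b′} {c} b⊆a mir))))) ,
      word-swap ws (≈-rel (j3 a′ b′ c b⊆a mir))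
      where
      c = proj₁ (mirror a′ b′ b⊆a)
      mir = proj₂ (mirror a′ b′ b⊆a)
      c⊆a = Reflection-contained {a′} {b′} {c} b⊆a mir

    rewrite-containing : Contained a′ b′ → Rewrites (b ∷ a ∷ ws) Swapped
    rewrite-containing a⊆b =
      ((α , C-symmetric b′ a′ α (proj₂ b) (proj₂ a) a⊆b mir) ∷ b ∷ ws) ,
      ((λ y → perm-conjugate {b′} {α} {a′} α⊆b mir⁻¹ (τ y)) ,
       cong₂ _∷_ (label-perm τ b′ α a′ (inside-perm-mirror {b′} {α} {a′} α⊆b mir⁻¹))
                 (cong (_∷ labels ws) (sym (label-perm τ a′ b′ b′ (inside-perm-within {b′} {a′} a⊆b))))) ,
      word-swap ws (≈-sym (≈-rel (j3 b′ α a′ α⊆b mir⁻¹)))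
      where
      α = proj₁ (mirror b′ a′ a⊆b)
      mir = proj₂ (mirror b′ a′ a⊆b)
      mir⁻¹ = Mirror-sym {lo b′} {hi b′} {lo a′} {hi a′} {lo α} {hi α} mir
      α⊆b = Reflection-contained {b′} {a′} {α} a⊆b mir

    rewrite-apart : Disjoint a′ b′ → Rewrites (b ∷ a ∷ ws) Swapped
    rewrite-apart d =
      (a ∷ b ∷ ws) ,
      ((λ y → perm-comm-apart {a′} {b′} d (τ y)) ,
       cong₂ _∷_ (label-perm τ b′ a′ a′ (inside-perm-apart {b′} {a′} (Apart-sym d)))
                 (cong (_∷ labels ws) (sym (label-perm τ a′ b′ b′ (inside-perm-apart {a′} {b′} d))))) ,
      word-swap ws (≈-rel (j2 a′ b′ d))

    rewrite-swap-head : Commute (label (perm a′ ∘ τ) b′) (label τ a′) → Rewrites (b ∷ a ∷ ws) Swapped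
    rewrite-swap-head c with nestedOrDisjoint-cases (label (perm a′ ∘ τ) b′) (label τ a′) c
    ... | inj₁ A⊆B        = rewrite-nested (contained-from-labels (permOf-onto ws) a′ b′ A⊆B)
    ... | inj₂ (inj₁ B⊆A) = rewrite-containing (containing-from-labels (permOf-onto ws) a′ b′ B⊆A)
    ... | inj₂ (inj₂ A∩B) = rewrite-apart (disjoint-from-labels (permOf-onto ws) a′ b′ A∩B)

  rewrite-swap : ∀ {X X′} → Swap X X′ → ∀ ws → labels ws ≡ X → Rewrites ws (permOf ws , X′)
  rewrite-swap (here c)  (b ∷ a ∷ ws) refl = rewrite-swap-head a b ws c
  rewrite-swap (there s) (k ∷ ws)     refl with rewrite-swap s ws refl
  ... | ws′ , (τ′≗τ , labels≡) , p =
    (k ∷ ws′) ,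
    ((λ y → cong (perm (proj₁ k)) (τ′≗τ y)) , cong₂ _∷_ (label-cong (proj₁ k) τ′≗τ) labels≡) ,
    ≈ᶜ-suffix (pos k ∷ []) p

  rewrite-∼ : ∀ {X X′} → X ∼ X′ → ∀ ws → labels ws ≡ X → Rewrites ws (permOf ws , X′)
  rewrite-∼ ε       ws e = ws , ((λ _ → refl) , e) , ≈-refl
  rewrite-∼ (s ◅ q) ws e with rewrite-swap s ws e
  ... | ws₁ , (τ₁≗τ , e₁) , p₁ with rewrite-∼ q ws₁ e₁
  ...   | ws₂ , (τ₂≗τ₁ , e₂) , p₂ = ws₂ , ((λ y → trans (τ₂≗τ₁ y) (τ₁≗τ y)) , e₂) , ≈-trans p₁ p₂

  cancel-last : ∀ ws (k g : CGen) → proj₁ k ≡ proj₁ g → word (g ∷ k ∷ ws) ≈ᶜ word ws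
  cancel-last ws k g k≡g =
    subst₂ _≈ᶜ_ (sym (List.++-assoc (word ws) (pos k ∷ []) (pos g ∷ []))) (List.++-identityʳ (word ws))
      (≈ᶜ-prefix (word ws) (square-≈ᶜ k g k≡g))

  rewrite-step : ∀ ws s (g : CGen) → Realises ws s → Rewrites (g ∷ ws) (step s (proj₁ g))
  rewrite-step ws (τ , x) g (τ′≗τ , e) with delete (label τ (proj₁ g)) x in d
  ... | nothing = (g ∷ ws) , ((λ y → cong (perm (proj₁ g)) (τ′≗τ y)) , cong₂ _∷_ (label-cong (proj₁ g) τ′≗τ) e) , ≈-refl
  ... | just x′ with rewrite-∼ (∼-sym (delete-just (label τ (proj₁ g)) x d)) ws e
  ...   | (k ∷ ws₂) , (τ₁≗τ′ , e₁) , p =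
    ws₂ , (τ₂≗ , List.∷-injectiveʳ e₁) , ≈-trans (≈ᶜ-suffix (pos g ∷ []) p) (cancel-last ws₂ k g (sym g≡k))
    where
    g′ = proj₁ g
    k′ = proj₁ k
    τ₁ = permOf (k ∷ ws₂)
    τ₁≗τ : ∀ y → τ₁ y ≡ τ y
    τ₁≗τ y = trans (τ₁≗τ′ y) (τ′≗τ y)
    g≡k : g′ ≡ k′
    g≡k = label-injective (permOf-onto (k ∷ ws₂)) g′ k′ (begin
      label τ₁ g′          ≡⟨ label-cong g′ τ₁≗τ ⟩
      label τ g′           ≡⟨ List.∷-injectiveˡ e₁ ⟨
      label (permOf ws₂) k′ ≡⟨ label-perm (permOf ws₂) k′ k′ k′ (inside-reflect (lo k′) (hi k′)) ⟨
      label τ₁ k′          ∎)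
      where open ≡-Reasoning
    τ₂≗ : ∀ y → permOf ws₂ y ≡ perm g′ (τ y)
    τ₂≗ y = begin
      permOf ws₂ y                ≡⟨ reflect-involutive (lo k′) (hi k′) (permOf ws₂ y) ⟨
      perm k′ (τ₁ y)              ≡⟨ cong₂ perm (sym g≡k) (τ₁≗τ y) ⟩
      perm g′ (τ y)               ∎
      where open ≡-Reasoning

  letter-generator : Letter CGen → CGen
  letter-generator (pos a) = a
  letter-generator (neg a) = a

  letter≈ᶜpos : ∀ l → (l ∷ []) ≈ᶜ (pos (letter-generator l) ∷ [])
  letter≈ᶜpos (pos a) = ≈-refl
  letter≈ᶜpos (neg a) = neg≈ᶜpos a

  generator-letter : ∀ l → generator (mapLetter proj₁ l) ≡ proj₁ (letter-generator l)
  generator-letter (pos a) = refl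
  generator-letter (neg a) = refl

  rewrite-word : ∀ (u : Word CGen) ws s → Realises ws s →
    Σ[ ws′ ∈ List CGen ] Realises ws′ (run s (mapWord proj₁ u)) × (word ws ++ u) ≈ᶜ word ws′
  rewrite-word []      ws s r = ws , r , subst (_≈ᶜ word ws) (sym (List.++-identityʳ (word ws))) ≈-refl
  rewrite-word (l ∷ u) ws s r with rewrite-step ws s (letter-generator l) r
  ... | ws₁ , r₁ , p₁ rewrite generator-letter l with rewrite-word u ws₁ _ r₁
  ...   | ws′ , r′ , p′ = ws′ , r′ , ≈-trans (subst (_≈ᶜ (word ws₁ ++ u)) (List.++-assoc (word ws) (l ∷ []) u)
                                                     (≈ᶜ-suffix u (≈-trans (≈ᶜ-prefix (word ws) (letter≈ᶜpos l)) p₁)))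
                                              p′

  labels-injective : ∀ ws₁ ws₂ → labels ws₁ ≡ labels ws₂ → word ws₁ ≈ᶜ word ws₂ × (∀ y → permOf ws₁ y ≡ permOf ws₂ y)
  labels-injective []        []        _ = ≈-refl , λ _ → refl
  labels-injective (a ∷ ws₁) (b ∷ ws₂) e with labels-injective ws₁ ws₂ (List.∷-injectiveʳ e)
  ... | p , τ₁≗τ₂ =
    ≈-trans (≈ᶜ-suffix (pos a ∷ []) p) (≈ᶜ-prefix (word ws₂) (pos-≈ᶜ a b a≡b)) ,
    λ y → cong₂ perm a≡b (τ₁≗τ₂ y)
    where
    a≡b : proj₁ a ≡ proj₁ b
    a≡b = label-injective (permOf-onto ws₂) (proj₁ a) (proj₁ b)
            (trans (sym (label-cong (proj₁ a) τ₁≗τ₂)) (List.∷-injectiveˡ e))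

  initial : State
  initial = (λ y → y) , []

  Realises-[] : Realises [] initial
  Realises-[] = (λ _ → refl) , refl

  complete : Complete (CactusRel n) C
  complete u v u≈v with rewrite-word u [] initial Realises-[] | rewrite-word v [] initial Realises-[]
  ... | wu , (_ , eu) , pu | wv , (_ , ev) , pv
    with rewrite-∼ (subst₂ _∼_ (sym eu) (sym ev) (proj₂ (run-resp-≈ u≈v initial tt))) wu refl
  ...   | w , (_ , e) , p = ≈-trans pu (≈-trans p (≈-trans (proj₁ (labels-injective w wv e)) (≈-sym pv)))

theorem3p7 : (n : ℕ) → 2 ≤ n → (C : Gen n → Set) → Symmetric C →
    Complete (CactusRel n) C
theorem3p7 n _ C C-symmetric = Completeness.complete n C C-symmetric
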